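{- For every positive integer $n$, $s(\mathbb{Z}_n,3)\le \lfloor n/4\rfloor$.
   Context: For an abelian group $G$ (written additively) and a positive integer $t$, a subset $S\subseteq G$ is $t$-free if for all non-negative integers $k,l$ with $k+l\le t$, a sum of $k$ (not necessarily distinct) elements of $S$ equals a sum of $l$ (not necessarily distinct) elements of $S$ only if $k=l$ and the two sums consist of the same terms (as multisets). $s(G,t)$ denotes the maximum cardinality of a $t$-free set in $G$; $\mathbb{Z}_n$ is the cyclic group of order $n$. -}

module Defs where

open import Data.Nat using (ℕ; _+_; _≤_; _%_; NonZero)
open import Data.Fin using (Fin; toℕ)
open import Data.Fin.Subset using (Subset; _∈_)
open import Data.List using (List; length; map)
open import Data.Nat.ListAction using (sum)
open import Data.List.Relation.Unary.All using (All)
open import Data.List.Relation.Binary.Permutation.Propositional using (_↭_)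
open import Relation.Binary.PropositionalEquality using (_≡_)

-- The cyclic group Z_n is represented by Fin n (residues 0..n-1).
-- The group sum of a finite list of elements of Z_n, as a residue mod n.
sumℤ : (n : ℕ) → .{{_ : NonZero n}} → List (Fin n) → ℕ
sumℤ n xs = sum (map toℕ xs) % n

-- S ⊆ Z_n is t-free: whenever a sum of k elements of S (list xs) equals a
-- sum of l elements of S (list ys) with k + l ≤ t, then the two sums consist
-- of the same terms as multisets (xs is a permutation of ys; this forces k = l).
IsTFree : (n : ℕ) → .{{_ : NonZero n}} → ℕ → Subset n → Set
IsTFree n t S =
  (xs ys : List (Fin n)) → All (_∈ S) xs → All (_∈ S) ys →
  length xs + length ys ≤ t → sumℤ n xs ≡ sumℤ n ys → xs ↭ ys

module Submission where

-- Fix a ∈ S. The four sets S, −S, a + S and a − S are pairwise disjoint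
-- and each has |S| elements, so 4|S| ≤ n. Every coincidence between two of
-- these images, say ±x ≡ a·[shifted] ± y, can be rearranged into a relation
-- Σ xs ≡ Σ ys between elements of S of total length at most 3 (after
-- cancelling a when both sides are shifted). By 3-freeness xs and ys are then
-- permutations of each other, hence of equal length. A relation between one
-- shifted and one unshifted image has odd total length 3 and is impossible;
-- a relation between two unshifted images has total length 2 and forces the
-- same sign and x = y.

open import Defs
open import Data.Nat using (ℕ; _≤_; _/_; NonZero)
open import Data.Fin.Subset using (Subset; ∣_∣)

open import Data.Bool using (Bool; true; false)
open import Data.Fin as Fin using (Fin; toℕ)
open import Data.Fin.Properties using (suc-injective; toℕ<n; toℕ-fromℕ<; injective⇒≤; *↔×; 2↔Bool)
open import Data.Fin.Subset using (inside; outside; _∈_)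
open import Data.List using (List; []; _∷_; [_]; _++_; length; map)
open import Data.List.Properties using (map-++; ∷-injectiveˡ)
open import Data.List.Relation.Unary.All as All using (All)
open import Data.List.Relation.Unary.All.Properties using (++⁺)
open import Data.List.Relation.Binary.Permutation.Propositional using (_↭_)
open import Data.List.Relation.Binary.Permutation.Propositional.Properties
  using (↭-length; ↭-singleton-inv)
open import Data.Nat using (zero; suc; _+_; _∸_; _*_; _%_; z≤n; ⌊_/2⌋)
open import Data.Nat.DivMod
  using (_mod_; %-distribˡ-+; [m+n]%n≡m%n; m%n%n≡m%n; m%n≤n; m%n<n; m*n/n≡m; /-monoˡ-≤)
open import Data.Nat.ListAction using (sum)
open import Data.Nat.ListAction.Properties using (sum-++)
open import Data.Nat.Properties
  using (+-commutativeSemigroup; +-assoc; *-comm; +-suc; +-identityʳ; m∸n+n≡m; <⇒≤;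
         n≡⌊n+n/2⌋; ≤-reflexive; ≤-trans; n≤1+n)
open import Algebra.Properties.CommutativeSemigroup +-commutativeSemigroup using (xy∙z≈xz∙y)
open import Data.Product using (_×_; _,_; map₁)
open import Data.Product.Function.NonDependent.Propositional using (_×-↔_)
open import Data.Vec using (_∷_)
open import Data.Vec.Base using (here; there)
open import Function using (_$_; _∘′_; _↔_; Injective; Injection)
open import Function.Construct.Composition using (_↔-∘_)
open import Function.Construct.Identity using (↔-id)
open import Function.Properties.Inverse using (↔⇒↣)
open import Relation.Binary.Bundles using (Setoid)
import Relation.Binary.Construct.On as On
open import Relation.Binary.PropositionalEquality
  using (_≡_; _≢_; refl; sym; trans; cong; cong₂; subst)
  renaming (setoid to ≡-setoid)
open import Relation.Nullary using (¬_; contradiction)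
open import Data.Empty using (⊥-elim)

double≢3 : ∀ k → k + k ≢ 3
double≢3 k k+k≡3 =
  contradiction (subst (λ j → j + j ≡ 3) (trans (n≡⌊n+n/2⌋ k) (cong ⌊_/2⌋ k+k≡3)) k+k≡3) λ ()

singleton-↭ : ∀ {A : Set} {x y : A} → [ x ] ↭ [ y ] → x ≡ y
singleton-↭ p = ∷-injectiveˡ (↭-singleton-inv p)

module Congruence (n : ℕ) .{{_ : NonZero n}} where

  ≡-mod : Setoid _ _
  ≡-mod = On.setoid (≡-setoid ℕ) (_% n)

  open Setoid ≡-mod public using (_≈_)
  open import Relation.Binary.Reasoning.Setoid ≡-mod public

  +-cong : ∀ {u v w z} → u ≈ v → w ≈ z → u + w ≈ v + z
  +-cong {u} {v} {w} {z} u≈v w≈z =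
    trans (%-distribˡ-+ u w n)
      (trans (cong₂ (λ s t → (s + t) % n) u≈v w≈z) (sym (%-distribˡ-+ v z n)))

  n≈0 : n ≈ 0
  n≈0 = [m+n]%n≡m%n 0 n

  -- Every w has an additive inverse mod n, so w can be cancelled.
  +-cancelˡ : ∀ w {u v} → w + u ≈ w + v → u ≈ v
  +-cancelˡ w {u} {v} e = begin
      u            ≈⟨ +-cong (sym inverse) refl ⟩
      c + w + u    ≡⟨ +-assoc c w u ⟩
      c + (w + u)  ≈⟨ +-cong {c} refl e ⟩
      c + (w + v)  ≡⟨ sym (+-assoc c w v) ⟩
      c + w + v    ≈⟨ +-cong inverse refl ⟩
      v            ∎
    where
    c : ℕ
    c = n ∸ w % n
    inverse : c + w ≈ 0
    inverse = begin
      c + w      ≈⟨ +-cong {c} refl (sym (m%n%n≡m%n w n)) ⟩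
      c + w % n  ≡⟨ m∸n+n≡m (m%n≤n w n) ⟩
      n          ≈⟨ n≈0 ⟩
      0          ∎

  mod-injective : ∀ {u v} → u mod n ≡ v mod n → u ≈ v
  mod-injective {u} {v} e =
    trans (sym (toℕ-fromℕ< (m%n<n u n))) (trans (cong toℕ e) (toℕ-fromℕ< (m%n<n v n)))

enum : ∀ {n} (p : Subset n) → Fin ∣ p ∣ → Fin n
enum (inside ∷ p) Fin.zero = Fin.zero
enum (inside ∷ p) (Fin.suc i) = Fin.suc (enum p i)
enum (outside ∷ p) i = Fin.suc (enum p i)

enum∈ : ∀ {n} (p : Subset n) (i : Fin ∣ p ∣) → enum p i ∈ p
enum∈ (inside ∷ p) Fin.zero = here
enum∈ (inside ∷ p) (Fin.suc i) = there (enum∈ p i)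
enum∈ (outside ∷ p) i = there (enum∈ p i)

enum-injective : ∀ {n} (p : Subset n) → Injective _≡_ _≡_ (enum p)
enum-injective (inside ∷ p) {Fin.zero} {Fin.zero} _ = refl
enum-injective (inside ∷ p) {Fin.suc i} {Fin.suc j} e =
  cong Fin.suc (enum-injective p (suc-injective e))
enum-injective (outside ∷ p) e = enum-injective p (suc-injective e)

↔-injective⇒≤ : ∀ {k n} {A : Set} → Fin k ↔ A → (f : A → Fin n) → Injective _≡_ _≡_ f → k ≤ n
↔-injective⇒≤ k↔A f f-injective =
  injective⇒≤ (λ e → Injection.injective (↔⇒↣ k↔A) (f-injective e))

Fin4m↔ : ∀ m → Fin (4 * m) ↔ ((Bool × Bool) × Fin m)
Fin4m↔ m = (((2↔Bool ×-↔ 2↔Bool) ↔-∘ *↔× {2} {2}) ×-↔ ↔-id (Fin m)) ↔-∘ *↔× {4} {m}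

-- 4m ≤ n gives m ≤ ⌊n/4⌋; the premise is needed only when m > 0, where
-- it may use a chosen element of Fin m.
bound-if-pointed : ∀ {n} m → (Fin m → 4 * m ≤ n) → m ≤ n / 4
bound-if-pointed zero _ = z≤n
bound-if-pointed {n} m@(suc _) pointed =
  subst (_≤ n / 4) (m*n/n≡m m 4) (/-monoˡ-≤ 4 (subst (_≤ n) (*-comm 4 m) (pointed Fin.zero)))

⟦_⟧ : ∀ {n} → List (Fin n) → ℕ
⟦ xs ⟧ = sum (map toℕ xs)

⟦⟧-++ : ∀ {n} (xs ys : List (Fin n)) → ⟦ xs ++ ys ⟧ ≡ ⟦ xs ⟧ + ⟦ ys ⟧
⟦⟧-++ xs ys = trans (cong sum (map-++ toℕ xs ys)) (sum-++ (map toℕ xs) (map toℕ ys))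

module SignedTerms (n : ℕ) .{{_ : NonZero n}} where
  open Congruence n

  record Represents (u : ℕ) (P M : List (Fin n)) : Set where
    constructor represents
    field congruence : u + ⟦ M ⟧ ≈ ⟦ P ⟧

  signed : Bool → Fin n → ℕ
  signed false x = toℕ x
  signed true x = n ∸ toℕ x

  plus minus : Bool → Fin n → List (Fin n)
  plus false x = [ x ]
  plus true _ = []
  minus false _ = []
  minus true x = [ x ]

  signed-represents : ∀ σ x → Represents (signed σ x) (plus σ x) (minus σ x)
  signed-represents false x = represents refl
  signed-represents true x = represents $ begin
    n ∸ toℕ x + (toℕ x + 0)  ≡⟨ cong (n ∸ toℕ x +_) (+-identityʳ (toℕ x)) ⟩
    n ∸ toℕ x + toℕ x        ≡⟨ m∸n+n≡m (<⇒≤ (toℕ<n x)) ⟩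
    n                        ≈⟨ n≈0 ⟩
    0                        ∎

  shift-represents : ∀ a {u P M} → Represents u P M → Represents (toℕ a + u) (a ∷ P) M
  shift-represents a {u} {P} {M} (represents r) = represents $ begin
    toℕ a + u + ⟦ M ⟧    ≡⟨ +-assoc (toℕ a) u ⟦ M ⟧ ⟩
    toℕ a + (u + ⟦ M ⟧)  ≈⟨ +-cong {toℕ a} refl r ⟩
    toℕ a + ⟦ P ⟧        ∎

  agreement⇒relation : ∀ {u v P M P' M'} → Represents u P M → Represents v P' M' →
                       u ≈ v → ⟦ P ++ M' ⟧ ≈ ⟦ P' ++ M ⟧
  agreement⇒relation {u} {v} {P} {M} {P'} {M'} (represents r) (represents r') u≈v = begin
    ⟦ P ++ M' ⟧        ≡⟨ ⟦⟧-++ P M' ⟩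
    ⟦ P ⟧ + ⟦ M' ⟧     ≈⟨ +-cong {w = ⟦ M' ⟧} (sym r) refl ⟩
    u + ⟦ M ⟧ + ⟦ M' ⟧  ≈⟨ +-cong {w = ⟦ M' ⟧} (+-cong {w = ⟦ M ⟧} u≈v refl) refl ⟩
    v + ⟦ M ⟧ + ⟦ M' ⟧  ≡⟨ xy∙z≈xz∙y v ⟦ M ⟧ ⟦ M' ⟧ ⟩
    v + ⟦ M' ⟧ + ⟦ M ⟧  ≈⟨ +-cong {w = ⟦ M ⟧} r' refl ⟩
    ⟦ P' ⟧ + ⟦ M ⟧     ≡⟨ sym (⟦⟧-++ P' M) ⟩
    ⟦ P' ++ M ⟧        ∎

  relation-length : ∀ σ σ' (x y : Fin n) →
                    length (plus σ x ++ minus σ' y) + length (plus σ' y ++ minus σ x) ≡ 2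
  relation-length false false _ _ = refl
  relation-length false true _ _ = refl
  relation-length true false _ _ = refl
  relation-length true true _ _ = refl

module ThreeFree (n : ℕ) .{{_ : NonZero n}} (S : Subset n) (free : IsTFree n 3 S) where
  open Congruence n
  open SignedTerms n

  InS : List (Fin n) → Set
  InS = All (_∈ S)

  plus-in : ∀ σ {x} → x ∈ S → InS (plus σ x)
  plus-in false x∈S = x∈S All.∷ All.[]
  plus-in true _ = All.[]

  minus-in : ∀ σ {x} → x ∈ S → InS (minus σ x)
  minus-in false _ = All.[]
  minus-in true x∈S = x∈S All.∷ All.[]

  -- A relation of total length 3 would be a permutation between lists whose
  -- lengths add up to an odd number.
  no-odd-relation : ∀ {xs ys} → InS xs → InS ys →
                    length xs + length ys ≡ 3 → ¬ ⟦ xs ⟧ ≈ ⟦ ys ⟧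
  no-odd-relation {xs} {ys} xs∈S ys∈S len e =
    double≢3 (length xs) (trans (cong (length xs +_) (↭-length xs↭ys)) len)
    where
    xs↭ys : xs ↭ ys
    xs↭ys = free xs ys xs∈S ys∈S (≤-reflexive len) e

  same-shift : ∀ σ σ' {x y} → x ∈ S → y ∈ S → signed σ x ≈ signed σ' y → σ ≡ σ' × x ≡ y
  same-shift σ σ' {x} {y} x∈S y∈S e = decode σ σ' relation
    where
    -- The agreement is a relation of total length 2, hence a permutation;
    -- its two sides have equal length only when the signs agree.
    relation : plus σ x ++ minus σ' y ↭ plus σ' y ++ minus σ x
    relation = free _ _ (++⁺ (plus-in σ x∈S) (minus-in σ' y∈S)) (++⁺ (plus-in σ' y∈S) (minus-in σ x∈S))
      (≤-trans (≤-reflexive (relation-length σ σ' x y)) (n≤1+n 2))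
      (agreement⇒relation (signed-represents σ x) (signed-represents σ' y) e)
    decode : ∀ σ σ' → plus σ x ++ minus σ' y ↭ plus σ' y ++ minus σ x → σ ≡ σ' × x ≡ y
    decode false false p = refl , singleton-↭ p
    decode true true p = refl , sym (singleton-↭ p)
    decode false true p = contradiction (↭-length p) λ ()
    decode true false p = contradiction (↭-length p) λ ()

  module Images (a : Fin n) (a∈S : a ∈ S) where

    -- A signed element never agrees with a signed element shifted by a:
    -- the resulting relation has length 3.
    different-shift : ∀ σ σ' {x y} → x ∈ S → y ∈ S → ¬ signed σ x ≈ toℕ a + signed σ' y
    different-shift σ σ' {x} {y} x∈S y∈S =
      no-odd-relation (++⁺ (plus-in σ x∈S) (minus-in σ' y∈S))
        (a∈S All.∷ ++⁺ (plus-in σ' y∈S) (minus-in σ x∈S))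
        (trans (+-suc (length (plus σ x ++ minus σ' y)) _) (cong suc (relation-length σ σ' x y)))
      ∘′ agreement⇒relation (signed-represents σ x) (shift-represents a (signed-represents σ' y))

    Form : Set
    Form = Bool × Bool

    image : Form → Fin n → ℕ
    image (false , σ) x = signed σ x
    image (true , σ) x = toℕ a + signed σ x

    -- Images of elements of S under two forms coincide only trivially;
    -- both-shifted coincidences reduce to unshifted ones by cancelling a.
    images-distinct : ∀ f f' {x y} → x ∈ S → y ∈ S → image f x ≈ image f' y → f ≡ f' × x ≡ y
    images-distinct (false , σ) (false , σ') x∈S y∈S e =
      map₁ (cong (false ,_)) (same-shift σ σ' x∈S y∈S e)
    images-distinct (true , σ) (true , σ') x∈S y∈S e =
      map₁ (cong (true ,_)) (same-shift σ σ' x∈S y∈S (+-cancelˡ (toℕ a) e))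
    images-distinct (false , σ) (true , σ') x∈S y∈S e = ⊥-elim (different-shift σ σ' x∈S y∈S e)
    images-distinct (true , σ) (false , σ') x∈S y∈S e = ⊥-elim (different-shift σ' σ y∈S x∈S (sym e))

    embed : Form × Fin ∣ S ∣ → Fin n
    embed (f , i) = image f (enum S i) mod n

    embed-injective : Injective _≡_ _≡_ embed
    embed-injective {f , i} {f' , j} e
      with images-distinct f f' (enum∈ S i) (enum∈ S j) (mod-injective e)
    ... | refl , enum-i≡enum-j = cong (f ,_) (enum-injective S enum-i≡enum-j)

    four-copies : 4 * ∣ S ∣ ≤ n
    four-copies = ↔-injective⇒≤ (Fin4m↔ ∣ S ∣) embed embed-injective

proposition11 : (n : ℕ) → .{{_ : NonZero n}} → (S : Subset n) →
    IsTFree n 3 S → ∣ S ∣ ≤ n / 4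
proposition11 n S free =
  bound-if-pointed ∣ S ∣ (λ i → Images.four-copies (enum S i) (enum∈ S i))
  where open ThreeFree n S free
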